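{- If $G$ is any blowup of $F_3$, then $\chi(G)\le\lceil\frac54\omega(G)\rceil$.
   Context: Graphs are finite and simple. $F_3$ is the 9-vertex graph with vertices $v_1,\ldots,v_6,x,y,z$ where $v_1\cdots v_6$ is an induced 6-cycle (edges $v_iv_{i+1}$, indices mod 6), $x,y,z$ are pairwise adjacent, and the neighbors of $x$, $y$, $z$ on the cycle are $\{v_1,v_2,v_3\}$, $\{v_3,v_4,v_5\}$, $\{v_5,v_6,v_1\}$ respectively. A blowup of a graph $H$ is any graph $G$ whose vertex set can be partitioned into $|V(H)|$ (not necessarily non-empty) cliques $Q_v$, $v\in V(H)$, such that for distinct $u,v$, every vertex of $Q_u$ is adjacent to every vertex of $Q_v$ if $uv\in E(H)$, and no vertex of $Q_u$ is adjacent to a vertex of $Q_v$ if $uv\notin E(H)$. $\chi$ is the chromatic number and $\omega$ the clique number. -}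

module Defs where

open import Data.Nat using (ℕ; zero; suc; _+_; _*_; _≤_)
open import Data.Nat.DivMod using (_/_)
open import Data.Fin using (Fin; toℕ)
open import Data.Bool using (Bool; true; false; _∨_; T)
open import Data.Product using (Σ; _×_; ∃-syntax)
open import Data.Sum using (_⊎_)
open import Data.Empty using (⊥)
open import Relation.Nullary using (¬_)
open import Relation.Binary.PropositionalEquality using (_≡_; _≢_)
open import Function.Bundles using (_⇔_)
open import Function.Definitions using (Injective)

record Graph (n : ℕ) : Set₁ where
  field
    Adj     : Fin n → Fin n → Set
    sym     : ∀ {u v} → Adj u v → Adj v u
    irrefl  : ∀ {u} → ¬ Adj u u
open Graph public

IsClique : ∀ {n} → Graph n → (k : ℕ) → (Fin k → Fin n) → Set
IsClique G k f = Injective _≡_ _≡_ f × (∀ i j → i ≢ j → Adj G (f i) (f j))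

IsCliqueNumber : ∀ {n} → Graph n → ℕ → Set
IsCliqueNumber G w =
  (Σ (Fin w → Fin _) (IsClique G w)) × (∀ k (f : Fin k → Fin _) → IsClique G k f → k ≤ w)

IsProperColouring : ∀ {n} → Graph n → (k : ℕ) → (Fin n → Fin k) → Set
IsProperColouring G k c = ∀ u v → Adj G u v → c u ≢ c v

Colourable : ∀ {n} → Graph n → ℕ → Set
Colourable G k = Σ (Fin _ → Fin k) (IsProperColouring G k)

-- F₃ on Fin 9: 0..5 = v₁..v₆, 6 = x, 7 = y, 8 = z.
f3edge : ℕ → ℕ → Bool
f3edge 0 1 = true
f3edge 1 2 = true
f3edge 2 3 = true
f3edge 3 4 = true
f3edge 4 5 = true
f3edge 5 0 = true
f3edge 6 7 = true
f3edge 6 8 = true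
f3edge 7 8 = true
f3edge 6 0 = true
f3edge 6 1 = true
f3edge 6 2 = true
f3edge 7 2 = true
f3edge 7 3 = true
f3edge 7 4 = true
f3edge 8 4 = true
f3edge 8 5 = true
f3edge 8 0 = true
f3edge _ _ = false

F3Adj : Fin 9 → Fin 9 → Set
F3Adj a b = T (f3edge (toℕ a) (toℕ b) ∨ f3edge (toℕ b) (toℕ a))

-- G is a blowup of F₃: the map p assigns each vertex to its part Q_{p(u)};
-- parts (possibly empty) are cliques, and distinct vertices in different parts
-- are adjacent exactly when their parts are adjacent in F₃.
IsBlowupOfF3 : ∀ {n} → Graph n → Set
IsBlowupOfF3 {n} G = Σ (Fin n → Fin 9) λ p → (∀ (u v : Fin n) → u ≢ v →
  (Adj G u v ⇔ (p u ≡ p v ⊎ F3Adj (p u) (p v))))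

ceil5/4 : ℕ → ℕ
ceil5/4 w = (5 * w + 3) / 4

module Submission where

-- Write Q_t for the part of G over the vertex t of F₃ and a(t) = |Q_t|.
-- The parts over a triangle of F₃ together form a clique of G, so a is a
-- weighting of F₃ in which every triangle weighs at most w = ω(G).  It then
-- suffices to find a weighted colouring of F₃ with k = ⌈5w/4⌉ colours: a set
-- of a(t) colours for every t, with disjoint sets on adjacent vertices; the
-- i-th vertex of Q_t gets the i-th colour of t.
--
-- The palette [0, k) is cut into consecutive blocks X, Y, Z of sizes a(x),
-- a(y), a(z) and a block F of the f = k - a(x) - a(y) - a(z) spare colours.
-- Each hub x, y, z takes its whole block; an even cycle vertex v₁, v₃, v₅
-- takes an initial piece of F and overflows into the start of the block of
-- the hub it misses; an odd vertex v₂, v₄, v₆ takes what its two cycle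
-- neighbours leave in F and in the two blocks of the hubs it misses.  What
-- this needs of the weights -- overflows fit into their blocks, and an odd
-- vertex is left at least its weight -- concerns only the weights around one
-- hub (a "sector") and follows from the five triangles through the hub and
-- 5w ≤ 4k; the hardest case, both even neighbours overflowing, adds up all
-- five triangles.

open import Defs renaming (sym to adj-sym)
open import Data.Nat
  using (ℕ; zero; suc; _+_; _*_; _∸_; _⊓_; _⊔_; _≤_; _<_; s≤s; _≤?_)
open import Data.Nat.Properties
  using ( ≤-refl; ≤-trans; ≤-reflexive; ≤-pred; <-irrefl; <-≤-trans; <⇒≢; ≰⇒≥; n≤1+n
        ; +-comm; +-assoc; +-identityʳ; m≤m+n; m≤n+m; +-mono-≤; +-monoˡ-≤; +-monoʳ-≤
        ; +-monoʳ-<; +-cancelˡ-≤; +-cancelʳ-≤; *-comm; *-monoˡ-≤; *-cancelˡ-≤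
        ; m≤n⇒∃[o]m+o≡n; m+[n∸m]≡n; m+n∸m≡n; m≤n⇒m∸n≡0; m≤n+o⇒m∸n≤o
        ; m≤n⇒m⊓n≡m; m≥n⇒m⊓n≡n; m⊓n≤m; m⊓n+n∸m≡n
        ; m≤n⇒m⊔n≡n; m≥n⇒m⊔n≡m; m≤m⊔n; m≤n⊔m; ⊔-lub; ⊔-idem; +-distribˡ-⊔
        ; module ≤-Reasoning )
open import Data.Nat.Tactic.RingSolver using (solve-∀)
open import Data.Nat.DivMod using (_%_; m≡m%n+[m/n]*n; m%n<n)
open import Data.Fin using (Fin; zero; suc; toℕ; fromℕ<; inject≤)
open import Data.Fin.Properties using (_≟_; all?; toℕ-fromℕ<; inject≤-injective)
open import Data.Unit using (tt)
open import Data.Empty using (⊥; ⊥-elim)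
open import Data.Product using (_×_; _,_; proj₂; ∃-syntax)
open import Data.Product.Properties using (≡-dec)
open import Data.Sum as Sum using (_⊎_; inj₁; inj₂; [_,_]′)
open import Data.List using (List; []; _∷_; _++_; length; lookup; filter; allFin; applyUpTo; map)
open import Data.Nat.ListAction using (sum)
open import Data.List.Properties using (length-++; length-applyUpTo)
open import Data.List.Relation.Unary.All as All using (All; []; _∷_)
open import Data.List.Relation.Unary.AllPairs using (AllPairs; []; _∷_)
open import Data.List.Relation.Unary.Any using (index; here; there)
open import Data.List.Relation.Unary.Any.Properties using (lookup-index)
open import Data.List.Relation.Unary.Unique.Propositional using (Unique)
open import Data.List.Relation.Unary.Unique.Propositional.Properties
  using (++⁺; filter⁺; allFin⁺; applyUpTo⁺₁)
open import Data.List.Relation.Binary.Disjoint.Propositional using (Disjoint)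
open import Data.List.Membership.Propositional using (_∈_)
open import Data.List.Membership.DecPropositional (≡-dec (_≟_ {9}) (_≟_ {9})) using (_∈?_)
open import Data.List.Membership.Propositional.Properties
  using (∈-lookup; ∈-++⁻; ∈-filter⁺; ∈-filter⁻; ∈-allFin; ∈-applyUpTo⁻)
open import Relation.Nullary using (¬_; yes; no)
open import Relation.Nullary.Decidable using (T?; ¬?; _→-dec_; _⊎-dec_; toWitness)
open import Relation.Binary.PropositionalEquality
  using (_≡_; _≢_; refl; sym; trans; cong; cong₂; subst; subst₂; module ≡-Reasoning)
open import Function using (_∘_)
open import Function.Bundles using (Equivalence; _⇔_)

lookup-injective : ∀ {A : Set} {xs : List A} → Unique xs →
                   ∀ i j → lookup xs i ≡ lookup xs j → i ≡ j
lookup-injective (_ ∷ _) zero zero _ = refl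
lookup-injective (x∉xs ∷ _) zero (suc j) e = ⊥-elim (All.lookup x∉xs (∈-lookup j) e)
lookup-injective (x∉xs ∷ _) (suc i) zero e = ⊥-elim (All.lookup x∉xs (∈-lookup i) (sym e))
lookup-injective (_ ∷ xs!) (suc i) (suc j) e = cong suc (lookup-injective xs! i j e)

module _ {n} (G : Graph n) where

  CliqueList : List (Fin n) → Set
  CliqueList L = Unique L × (∀ {u v} → u ∈ L → v ∈ L → u ≢ v → Adj G u v)

  cliqueList-bound : ∀ {w L} → (∀ k f → IsClique G k f → k ≤ w) →
                     CliqueList L → length L ≤ w
  cliqueList-bound {L = L} maximal (L! , adjacent) =
    maximal _ (lookup L) ((λ {i} {j} → lookup-injective L! i j) ,
      λ i j i≢j → adjacent (∈-lookup i) (∈-lookup j) (i≢j ∘ lookup-injective L! i j))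

  join : ∀ {L L′} → CliqueList L → CliqueList L′ →
         (∀ {u v} → u ∈ L → v ∈ L′ → Adj G u v) → CliqueList (L ++ L′)
  join {L} {L′} (L! , inL) (L′! , inL′) across = ++⁺ L! L′! disjoint , adjacent
    where
    disjoint : Disjoint L L′
    disjoint (u∈L , u∈L′) = irrefl G (across u∈L u∈L′)

    adjacent : ∀ {u v} → u ∈ L ++ L′ → v ∈ L ++ L′ → u ≢ v → Adj G u v
    adjacent u∈ v∈ u≢v with ∈-++⁻ L u∈ | ∈-++⁻ L v∈
    ... | inj₁ u∈L  | inj₁ v∈L  = inL u∈L v∈L u≢v
    ... | inj₁ u∈L  | inj₂ v∈L′ = across u∈L v∈L′
    ... | inj₂ u∈L′ | inj₁ v∈L  = adj-sym G (across v∈L u∈L′)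
    ... | inj₂ u∈L′ | inj₂ v∈L′ = inL′ u∈L′ v∈L′ u≢v

record WeightedColouring {m} (HAdj : Fin m → Fin m → Set) (c : Fin m → ℕ) (k : ℕ) : Set where
  field
    colours   : Fin m → List ℕ
    distinct  : ∀ t → Unique (colours t)
    bounded   : ∀ t {i} → i ∈ colours t → i < k
    enough    : ∀ t → c t ≤ length (colours t)
    separated : ∀ {s t} → HAdj s t → Disjoint (colours s) (colours t)

module Blowup {n m} (G : Graph n) (HAdj : Fin m → Fin m → Set)
  (H-irrefl : ∀ {t} → ¬ HAdj t t) (p : Fin n → Fin m)
  (blowup : ∀ u v → u ≢ v → Adj G u v ⇔ (p u ≡ p v ⊎ HAdj (p u) (p v)))
  where

  part : Fin m → List (Fin n)
  part t = filter (λ v → p v ≟ t) (allFin n)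

  size : Fin m → ℕ
  size t = length (part t)

  ∈-part⁺ : ∀ u → u ∈ part (p u)
  ∈-part⁺ u = ∈-filter⁺ (λ v → p v ≟ p u) (∈-allFin u) refl

  ∈-part⁻ : ∀ {t u} → u ∈ part t → p u ≡ t
  ∈-part⁻ {t} u∈ = proj₂ (∈-filter⁻ (λ v → p v ≟ t) {xs = allFin n} u∈)

  part-clique : ∀ t → CliqueList G (part t)
  part-clique t = filter⁺ (λ v → p v ≟ t) (allFin⁺ n) , λ u∈ v∈ u≢v →
    Equivalence.from (blowup _ _ u≢v) (inj₁ (trans (∈-part⁻ u∈) (sym (∈-part⁻ v∈))))

  parts-joined : ∀ {s t u v} → HAdj s t → u ∈ part s → v ∈ part t → Adj G u v
  parts-joined {s} {t} {u} {v} st u∈ v∈ = Equivalence.from (blowup u v u≢v) (inj₂ pu-pv)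
    where
    pu-pv : HAdj (p u) (p v)
    pu-pv = subst₂ HAdj (sym (∈-part⁻ u∈)) (sym (∈-part⁻ v∈)) st
    u≢v : u ≢ v
    u≢v refl = H-irrefl pu-pv

  triangle-bound : ∀ {w} → (∀ k f → IsClique G k f → k ≤ w) →
                   ∀ s t r → HAdj s t → HAdj s r → HAdj t r →
                   size s + size t + size r ≤ w
  triangle-bound maximal s t r st sr tr =
    subst (_≤ _) total (cliqueList-bound G maximal
      (join G (join G (part-clique s) (part-clique t) (parts-joined st))
              (part-clique r) toR))
    where
    toR : ∀ {u v} → u ∈ part s ++ part t → v ∈ part r → Adj G u v
    toR u∈ v∈ = [ (λ u∈s → parts-joined sr u∈s v∈) , (λ u∈t → parts-joined tr u∈t v∈) ]′
                  (∈-++⁻ (part s) u∈)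

    total : length ((part s ++ part t) ++ part r) ≡ size s + size t + size r
    total = trans (length-++ (part s ++ part t)) (cong (_+ size r) (length-++ (part s)))

  -- A weighted colouring of H for the part sizes colours G: the i-th vertex
  -- of the part Q_t receives the i-th colour of t.
  colour-blowup : ∀ {k} → WeightedColouring HAdj size k → Colourable G k
  colour-blowup {k} W = colour , proper
    where
    open WeightedColouring W

    colourIn : ∀ {t u} → u ∈ part t → ℕ
    colourIn {t} u∈ = lookup (colours t) (inject≤ (index u∈) (enough t))

    colourIn-∈ : ∀ {t u} (u∈ : u ∈ part t) → colourIn u∈ ∈ colours t
    colourIn-∈ _ = ∈-lookup _

    colourIn-injective : ∀ {t t′ u v} (u∈ : u ∈ part t) (v∈ : v ∈ part t′) →
                         t ≡ t′ → colourIn u∈ ≡ colourIn v∈ → u ≡ v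
    colourIn-injective {t} {u = u} {v} u∈ v∈ refl same = begin
      u                               ≡⟨ lookup-index u∈ ⟩
      lookup (part t) (index u∈)      ≡⟨ cong (lookup (part t)) same-index ⟩
      lookup (part t) (index v∈)      ≡⟨ sym (lookup-index v∈) ⟩
      v                               ∎
      where
      open ≡-Reasoning
      same-index : index u∈ ≡ index v∈
      same-index = inject≤-injective _ _ _ _ (lookup-injective (distinct t) _ _ same)

    colour : Fin n → Fin k
    colour u = fromℕ< (bounded (p u) (colourIn-∈ (∈-part⁺ u)))

    colour-injective : ∀ {u v} → colour u ≡ colour v →
                       colourIn (∈-part⁺ u) ≡ colourIn (∈-part⁺ v)
    colour-injective same = trans (sym (toℕ-fromℕ< _)) (trans (cong toℕ same) (toℕ-fromℕ< _))

    proper : IsProperColouring G k colour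
    proper u v uv same with Equivalence.to (blowup u v (λ { refl → irrefl G uv })) uv
    ... | inj₁ pu≡pv =
      irrefl G (subst (Adj G u) (sym (colourIn-injective _ _ pu≡pv (colour-injective same))) uv)
    ... | inj₂ puv = separated puv
      (colourIn-∈ (∈-part⁺ u) , subst (_∈ colours (p v)) (sym (colour-injective same)) (colourIn-∈ (∈-part⁺ v)))

five-quarters : ∀ w → 5 * w ≤ 4 * ceil5/4 w
five-quarters w = +-cancelʳ-≤ 3 _ _ (begin
    5 * w + 3           ≡⟨ m≡m%n+[m/n]*n (5 * w + 3) 4 ⟩
    (5 * w + 3) % 4 + q * 4 ≤⟨ +-monoˡ-≤ (q * 4) (≤-pred (m%n<n (5 * w + 3) 4)) ⟩
    3 + q * 4           ≡⟨ +-comm 3 (q * 4) ⟩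
    q * 4 + 3           ≡⟨ cong (_+ 3) (*-comm q 4) ⟩
    4 * q + 3           ∎)
  where
  open ≤-Reasoning
  q = ceil5/4 w

quarter-bound : ∀ {w K} → 5 * w ≤ 4 * K → w ≤ K
quarter-bound {w} 5w≤4K = *-cancelˡ-≤ 4 (≤-trans (*-monoˡ-≤ w (n≤1+n 4)) 5w≤4K)

cancel : ∀ c {l r l′ r′} → l ≤ r → l ≡ c + l′ → r ≡ c + r′ → l′ ≤ r′
cancel c l≤r refl refl = +-cancelˡ-≤ c _ _ l≤r

data Versus (f : ℕ) : ℕ → Set where
  fits      : ∀ {a} → a ≤ f → Versus f a
  overflows : ∀ d → Versus f (f + d)

versus : ∀ f a → Versus f a
versus f a with a ≤? f
... | yes a≤f = fits a≤f
... | no a≰f with d , refl ← m≤n⇒∃[o]m+o≡n (≰⇒≥ a≰f) = overflows d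

leftover : ∀ {b p q r P Q R} → p ≤ P → q ≤ Q → r ≤ R →
           b + p + q + r ≤ P + Q + R → b ≤ sum ((P ∸ p) ∷ (Q ∸ q) ∷ (R ∸ r) ∷ [])
leftover {b} {p} {q} {r} p≤P q≤Q r≤R fit
  with P , refl ← m≤n⇒∃[o]m+o≡n p≤P
     | Q , refl ← m≤n⇒∃[o]m+o≡n q≤Q
     | R , refl ← m≤n⇒∃[o]m+o≡n r≤R
  rewrite m+n∸m≡n p P | m+n∸m≡n q Q | m+n∸m≡n r R
  = cancel (p + q + r) fit (regroupₗ b p q r) (regroupᵣ p q r P Q R)
  where
  regroupₗ : ∀ b p q r → b + p + q + r ≡ p + q + r + b
  regroupₗ = solve-∀
  regroupᵣ : ∀ p q r P Q R → p + P + (q + Q) + (r + R) ≡ p + q + r + (P + (Q + (R + 0)))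
  regroupᵣ = solve-∀

-- One sector of F₃: a hub x with the other hubs y, z, and the cycle path
-- a b c through the neighbours of x, where a also sees z and c also sees y
-- (for the hub x of F₃: a, b, c = v₁, v₂, v₃).  The hypotheses are the five
-- triangles through x and the budget 5w ≤ 4k for k = x + y + z + f colours.
-- The even vertices a and c use f ⊓ a and f ⊓ c spare colours and overflow
-- by a ∸ f into the block of y and by c ∸ f into that of z.
module Sector {w f x y z a b c : ℕ}
  (zxa : z + x + a ≤ w) (xab : x + a + b ≤ w) (xbc : x + b + c ≤ w)
  (xyc : x + y + c ≤ w) (xyz : x + y + z ≤ w)
  (budget : 5 * w ≤ 4 * (x + y + z + f)) where

  w≤k : w ≤ x + y + z + f
  w≤k = quarter-bound budget

  split-x : x + y + z + f ≡ x + (y + z + f)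
  split-x = trans (cong (_+ f) (+-assoc x y z)) (+-assoc x (y + z) f)

  overflow-a : a ∸ f ≤ y
  overflow-a = m≤n+o⇒m∸n≤o a f (cancel (z + x) (≤-trans zxa w≤k) refl (regroup x y z f))
    where
    regroup : ∀ x y z f → x + y + z + f ≡ z + x + (f + y)
    regroup = solve-∀

  overflow-c : c ∸ f ≤ z
  overflow-c = m≤n+o⇒m∸n≤o c f (cancel (x + y) (≤-trans xyc w≤k) refl (regroup x y z f))
    where
    regroup : ∀ x y z f → x + y + z + f ≡ x + y + (f + z)
    regroup = solve-∀

  with-a : a + b ≤ y + z + f
  with-a = cancel x (≤-trans xab w≤k) (+-assoc x a b) split-x

  with-c : b + c ≤ y + z + f
  with-c = cancel x (≤-trans xbc w≤k) (+-assoc x b c) split-x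

  with-larger : b + (a ⊔ c) ≤ y + z + f
  with-larger = subst (_≤ y + z + f) (sym (+-distribˡ-⊔ b a c))
                  (⊔-lub (subst (_≤ y + z + f) (+-comm a b) with-a) with-c)

  -- All five triangles through x together, against 5w ≤ 4(x + y + z + f).
  with-both : a + b + c ≤ y + z + 2 * f
  with-both = *-cancelˡ-≤ 2 (≤-trans (m≤n+m _ x)
                (cancel (4 * x + 2 * y + 2 * z) five-triangles (sum≡ x y z a b c) (budget≡ x y z f)))
    where
    five-w : ∀ w → w + w + w + w + w ≡ 5 * w
    five-w = solve-∀
    sum≡ : ∀ x y z a b c → (z + x + a) + (x + a + b) + (x + b + c) + (x + y + c) + (x + y + z)
                         ≡ (4 * x + 2 * y + 2 * z) + (x + 2 * (a + b + c))
    sum≡ = solve-∀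
    budget≡ : ∀ x y z f → 4 * (x + y + z + f) ≡ (4 * x + 2 * y + 2 * z) + 2 * (y + z + 2 * f)
    budget≡ = solve-∀
    five-triangles : (z + x + a) + (x + a + b) + (x + b + c) + (x + y + c) + (x + y + z)
                     ≤ 4 * (x + y + z + f)
    five-triangles = ≤-trans (+-mono-≤ (+-mono-≤ (+-mono-≤ (+-mono-≤ zxa xab) xbc) xyc) xyz)
                       (≤-trans (≤-reflexive (five-w w)) budget)

  -- b, together with all colours that its neighbours a and c take from the
  -- blocks of y and z and from the spare block, fits into y + z + f.
  demand : b + (a ∸ f) + (c ∸ f) + ((f ⊓ a) ⊔ (f ⊓ c)) ≤ y + z + f
  demand with versus f a | versus f c
  ... | fits a≤f | fits c≤f
    rewrite m≤n⇒m∸n≡0 a≤f | m≤n⇒m∸n≡0 c≤f | m≥n⇒m⊓n≡n a≤f | m≥n⇒m⊓n≡n c≤f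
    = subst (_≤ y + z + f) (regroup b (a ⊔ c)) with-larger
    where
    regroup : ∀ b m → b + m ≡ b + 0 + 0 + m
    regroup = solve-∀
  ... | overflows d | fits c≤f
    rewrite m+n∸m≡n f d | m≤n⇒m∸n≡0 c≤f | m≤n⇒m⊓n≡m (m≤m+n f d) | m≥n⇒m⊓n≡n c≤f | m≥n⇒m⊔n≡m c≤f
    = subst (_≤ y + z + f) (regroup f d b) with-a
    where
    regroup : ∀ f d b → f + d + b ≡ b + d + 0 + f
    regroup = solve-∀
  ... | fits a≤f | overflows e
    rewrite m≤n⇒m∸n≡0 a≤f | m+n∸m≡n f e | m≥n⇒m⊓n≡n a≤f | m≤n⇒m⊓n≡m (m≤m+n f e) | m≤n⇒m⊔n≡n a≤f
    = subst (_≤ y + z + f) (regroup f e b) with-c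
    where
    regroup : ∀ f e b → b + (f + e) ≡ b + 0 + e + f
    regroup = solve-∀
  ... | overflows d | overflows e
    rewrite m+n∸m≡n f d | m+n∸m≡n f e | m≤n⇒m⊓n≡m (m≤m+n f d) | m≤n⇒m⊓n≡m (m≤m+n f e) | ⊔-idem f
    = cancel f with-both (regroupₗ f d b e) (regroupᵣ y z f)
    where
    regroupₗ : ∀ f d b e → f + d + b + (f + e) ≡ f + (b + d + e + f)
    regroupₗ = solve-∀
    regroupᵣ : ∀ y z f → y + z + 2 * f ≡ f + (y + z + f)
    regroupᵣ = solve-∀

  capacity : b ≤ sum ((y ∸ (a ∸ f)) ∷ (z ∸ (c ∸ f)) ∷ (f ∸ ((f ⊓ a) ⊔ (f ⊓ c))) ∷ [])
  capacity = leftover overflow-a overflow-c (⊔-lub (m⊓n≤m f a) (m⊓n≤m f c)) demand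

data Block : Set where
  X Y Z F : Block

-- A segment: the positions [lo, hi) of a block.
record Segment : Set where
  constructor seg
  field
    block : Block
    lo hi : ℕ

width : Segment → ℕ
width (seg _ l h) = h ∸ l

Apart : Segment → Segment → Set
Apart (seg T l h) (seg T′ l′ h′) = T ≡ T′ → h ≤ l′ ⊎ h′ ≤ l

before : ∀ {T l h l′ h′} → h ≤ l′ → Apart (seg T l h) (seg T l′ h′)
before h≤l′ _ = inj₁ h≤l′

after : ∀ {T l h l′ h′} → h′ ≤ l → Apart (seg T l h) (seg T l′ h′)
after h′≤l _ = inj₂ h′≤l

AllApart : List Segment → List Segment → Set
AllApart ss ss′ = All (λ s → All (Apart s) ss′) ss

AllApart-sym : ∀ {ss ss′} → AllApart ss ss′ → AllApart ss′ ss
AllApart-sym apart = All.tabulate λ s′∈ → All.tabulate λ s∈ →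
  apart-sym (All.lookup (All.lookup apart s∈) s′∈)
  where
  apart-sym : ∀ {s s′} → Apart s s′ → Apart s′ s
  apart-sym {seg _ _ _} {seg _ _ _} ap T≡T′ = Sum.swap (ap (sym T≡T′))

+-<-∸ : ∀ l h {i} → i < h ∸ l → l + i < h
+-<-∸ zero h i<h = i<h
+-<-∸ (suc l) (suc h) i<h∸l = s≤s (+-<-∸ l h i<h∸l)

module Palette (size : Block → ℕ) where

  base : Block → ℕ
  base X = 0
  base Y = size X
  base Z = size X + size Y
  base F = size X + size Y + size Z

  total : ℕ
  total = base F + size F

  X≤Z : size X ≤ base Z
  X≤Z = m≤m+n (size X) (size Y)

  X≤F : size X ≤ base F
  X≤F = ≤-trans X≤Z (m≤m+n (base Z) (size Z))

  Y≤F : base Y + size Y ≤ base F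
  Y≤F = m≤m+n (base Z) (size Z)

  block-order : ∀ T T′ → T ≡ T′ ⊎ (base T + size T ≤ base T′ ⊎ base T′ + size T′ ≤ base T)
  block-order X X = inj₁ refl
  block-order Y Y = inj₁ refl
  block-order Z Z = inj₁ refl
  block-order F F = inj₁ refl
  block-order X Y = inj₂ (inj₁ ≤-refl)
  block-order X Z = inj₂ (inj₁ X≤Z)
  block-order X F = inj₂ (inj₁ X≤F)
  block-order Y Z = inj₂ (inj₁ ≤-refl)
  block-order Y F = inj₂ (inj₁ Y≤F)
  block-order Z F = inj₂ (inj₁ ≤-refl)
  block-order Y X = inj₂ (inj₂ ≤-refl)
  block-order Z X = inj₂ (inj₂ X≤Z)
  block-order F X = inj₂ (inj₂ X≤F)
  block-order Z Y = inj₂ (inj₂ ≤-refl)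
  block-order F Y = inj₂ (inj₂ Y≤F)
  block-order F Z = inj₂ (inj₂ ≤-refl)

  block-end : ∀ T → base T + size T ≤ total
  block-end X = ≤-trans X≤F (m≤m+n (base F) (size F))
  block-end Y = ≤-trans Y≤F (m≤m+n (base F) (size F))
  block-end Z = m≤m+n (base F) (size F)
  block-end F = ≤-refl

  Valid : Segment → Set
  Valid (seg T l h) = h ≤ size T

  ⟦_⟧ : Segment → List ℕ
  ⟦ seg T l h ⟧ = applyUpTo (λ i → base T + (l + i)) (h ∸ l)

  record Inside (c : ℕ) (s : Segment) : Set where
    constructor inside
    open Segment s
    field
      from  : base block + lo ≤ c
      below : c < base block + hi

  ∈-segment⁻ : ∀ s {c} → c ∈ ⟦ s ⟧ → Inside c s
  ∈-segment⁻ (seg T l h) c∈ with i , i<h∸l , refl ← ∈-applyUpTo⁻ _ c∈ =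
    inside (+-monoʳ-≤ (base T) (m≤m+n l i)) (+-monoʳ-< (base T) (+-<-∸ l h i<h∸l))

  segment-unique : ∀ s → Unique ⟦ s ⟧
  segment-unique (seg T l h) =
    applyUpTo⁺₁ _ (h ∸ l) λ i<j _ → <⇒≢ (+-monoʳ-< (base T) (+-monoʳ-< l i<j))

  ordered-segments : ∀ {c s s′} → let open Segment in
                     base (block s) + hi s ≤ base (block s′) + lo s′ →
                     Inside c s → Inside c s′ → ⊥
  ordered-segments end≤start (inside _ c<end) (inside start≤c _) =
    <-irrefl refl (<-≤-trans c<end (≤-trans end≤start start≤c))

  segments-disjoint : ∀ {s s′} → Valid s → Valid s′ → Apart s s′ → Disjoint ⟦ s ⟧ ⟦ s′ ⟧
  segments-disjoint {s@(seg T l h)} {s′@(seg T′ l′ h′)} h≤ h′≤ apart (c∈ , c∈′)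
    with block-order T T′ | ∈-segment⁻ s c∈ | ∈-segment⁻ s′ c∈′
  ... | inj₁ refl | c-in | c-in′ =
    [ (λ h≤l′ → ordered-segments (+-monoʳ-≤ (base T) h≤l′) c-in c-in′)
    , (λ h′≤l → ordered-segments (+-monoʳ-≤ (base T) h′≤l) c-in′ c-in) ]′ (apart refl)
  ... | inj₂ (inj₁ T-first) | c-in | c-in′ =
    ordered-segments (≤-trans (+-monoʳ-≤ (base T) h≤) (≤-trans T-first (m≤m+n (base T′) l′))) c-in c-in′
  ... | inj₂ (inj₂ T′-first) | c-in | c-in′ =
    ordered-segments (≤-trans (+-monoʳ-≤ (base T′) h′≤) (≤-trans T′-first (m≤m+n (base T) l))) c-in′ c-in

  colours : List Segment → List ℕ
  colours [] = []
  colours (s ∷ ss) = ⟦ s ⟧ ++ colours ss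

  ∈-colours⁻ : ∀ ss {c} → c ∈ colours ss → ∃[ s ] s ∈ ss × c ∈ ⟦ s ⟧
  ∈-colours⁻ (s ∷ ss) c∈ with ∈-++⁻ ⟦ s ⟧ c∈
  ... | inj₁ c∈s = s , here refl , c∈s
  ... | inj₂ c∈ss with s′ , s′∈ , c∈s′ ← ∈-colours⁻ ss c∈ss = s′ , there s′∈ , c∈s′

  length-colours : ∀ ss → length (colours ss) ≡ sum (map width ss)
  length-colours [] = refl
  length-colours (seg T l h ∷ ss) =
    trans (length-++ ⟦ seg T l h ⟧) (cong₂ _+_ (length-applyUpTo _ (h ∸ l)) (length-colours ss))

  colours-bounded : ∀ {ss c} → All Valid ss → c ∈ colours ss → c < total
  colours-bounded {ss} valid c∈ with seg T l h , s∈ , c∈s ← ∈-colours⁻ ss c∈ =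
    <-≤-trans (Inside.below (∈-segment⁻ (seg T l h) c∈s)) (≤-trans (+-monoʳ-≤ (base T) (All.lookup valid s∈)) (block-end T))

  colours-disjoint : ∀ {ss ss′} → All Valid ss → All Valid ss′ → AllApart ss ss′ →
                     Disjoint (colours ss) (colours ss′)
  colours-disjoint {ss} {ss′} valid valid′ apart (c∈ , c∈′)
    with s , s∈ , c∈s ← ∈-colours⁻ ss c∈ | s′ , s′∈ , c∈s′ ← ∈-colours⁻ ss′ c∈′ =
    segments-disjoint (All.lookup valid s∈) (All.lookup valid′ s′∈)
      (All.lookup (All.lookup apart s∈) s′∈) (c∈s , c∈s′)

  colours-unique : ∀ {ss} → All Valid ss → AllPairs Apart ss → Unique (colours ss)
  colours-unique [] [] = []
  colours-unique {s ∷ ss} (valid ∷ valids) (apart ∷ aparts) =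
    ++⁺ (segment-unique s) (colours-unique valids aparts) disjoint
    where
    disjoint : Disjoint ⟦ s ⟧ (colours ss)
    disjoint (c∈s , c∈ss) with s′ , s′∈ , c∈s′ ← ∈-colours⁻ ss c∈ss =
      segments-disjoint valid (All.lookup valids s′∈) (All.lookup apart s′∈) (c∈s , c∈s′)

  record Layout {m} (HAdj : Fin m → Fin m → Set) (c : Fin m → ℕ) : Set where
    field
      segments  : Fin m → List Segment
      valid     : ∀ t → All Valid (segments t)
      internal  : ∀ t → AllPairs Apart (segments t)
      separated : ∀ {s t} → HAdj s t → AllApart (segments s) (segments t)
      wide      : ∀ t → c t ≤ sum (map width (segments t))

  layout-colouring : ∀ {m} {HAdj : Fin m → Fin m → Set} {c} →
                     Layout HAdj c → WeightedColouring HAdj c total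
  layout-colouring {c = c} L = record
    { colours   = colours ∘ segments
    ; distinct  = λ t → colours-unique (valid t) (internal t)
    ; bounded   = λ t → colours-bounded (valid t)
    ; enough    = λ t → subst (c t ≤_) (sym (length-colours (segments t))) (wide t)
    ; separated = λ st → colours-disjoint (valid _) (valid _) (separated st)
    }
    where open Layout L

pattern v₁ = zero
pattern v₂ = suc v₁
pattern v₃ = suc v₂
pattern v₄ = suc v₃
pattern v₅ = suc v₄
pattern v₆ = suc v₅
pattern x  = suc v₆
pattern y  = suc x
pattern z  = suc y

F3-irreflexive : ∀ t → ¬ F3Adj t t
F3-irreflexive = toWitness {a? = all? λ t → ¬? (T? _)} _

edges : List (Fin 9 × Fin 9)
edges = (v₁ , v₂) ∷ (v₂ , v₃) ∷ (v₃ , v₄) ∷ (v₄ , v₅) ∷ (v₅ , v₆) ∷ (v₆ , v₁)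
      ∷ (x , y) ∷ (y , z) ∷ (z , x)
      ∷ (x , v₁) ∷ (x , v₂) ∷ (x , v₃) ∷ (y , v₃) ∷ (y , v₄) ∷ (y , v₅)
      ∷ (z , v₅) ∷ (z , v₆) ∷ (z , v₁) ∷ []

adjacent⇒edge : ∀ s t → F3Adj s t → (s , t) ∈ edges ⊎ (t , s) ∈ edges
adjacent⇒edge = toWitness
  {a? = all? λ s → all? λ t → T? _ →-dec ((s , t) ∈? edges ⊎-dec (t , s) ∈? edges)} _


module F3Layout (a : Fin 9 → ℕ) (w : ℕ)
  (triangle : ∀ s t r → F3Adj s t → F3Adj s r → F3Adj t r → a s + a t + a r ≤ w) where

  k : ℕ
  k = ceil5/4 w

  f : ℕ
  f = k ∸ (a x + a y + a z)

  sizes : Block → ℕ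
  sizes X = a x
  sizes Y = a y
  sizes Z = a z
  sizes F = f

  open Palette sizes

  -- The hub triangle fits into k colours, so the palette has exactly k colours.
  total≡k : total ≡ k
  total≡k = m+[n∸m]≡n (≤-trans (triangle x y z tt tt tt) (quarter-bound (five-quarters w)))

  budget : 5 * w ≤ 4 * (a x + a y + a z + f)
  budget = subst (λ K → 5 * w ≤ 4 * K) (sym total≡k) (five-quarters w)

  -- Turning F₃ by a third: the budget with the hubs listed from the next one.
  rotate : ∀ p q r → 5 * w ≤ 4 * (p + q + r + f) → 5 * w ≤ 4 * (q + r + p + f)
  rotate p q r = subst (λ K → 5 * w ≤ 4 * K) (regroup p q r f)
    where
    regroup : ∀ p q r f → p + q + r + f ≡ q + r + p + f
    regroup = solve-∀

  budget-y : 5 * w ≤ 4 * (a y + a z + a x + f)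
  budget-y = rotate (a x) (a y) (a z) budget

  budget-z : 5 * w ≤ 4 * (a z + a x + a y + f)
  budget-z = rotate (a y) (a z) (a x) budget-y

  module Sx = Sector {w} {f} {a x} {a y} {a z} {a v₁} {a v₂} {a v₃}
    (triangle z x v₁ tt tt tt) (triangle x v₁ v₂ tt tt tt)
    (triangle x v₂ v₃ tt tt tt) (triangle x y v₃ tt tt tt) (triangle x y z tt tt tt) budget
  module Sy = Sector {w} {f} {a y} {a z} {a x} {a v₃} {a v₄} {a v₅}
    (triangle x y v₃ tt tt tt) (triangle y v₃ v₄ tt tt tt)
    (triangle y v₄ v₅ tt tt tt) (triangle y z v₅ tt tt tt) (triangle y z x tt tt tt) budget-y
  module Sz = Sector {w} {f} {a z} {a x} {a y} {a v₅} {a v₆} {a v₁}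
    (triangle y z v₅ tt tt tt) (triangle z v₅ v₆ tt tt tt)
    (triangle z v₆ v₁ tt tt tt) (triangle z x v₁ tt tt tt) (triangle z x y tt tt tt) budget-z

  spare overflow : Fin 9 → ℕ
  spare e = f ⊓ a e
  overflow e = a e ∸ f

  segments : Fin 9 → List Segment
  segments x  = seg X 0 (a x) ∷ []
  segments y  = seg Y 0 (a y) ∷ []
  segments z  = seg Z 0 (a z) ∷ []
  segments v₁ = seg F 0 (spare v₁) ∷ seg Y 0 (overflow v₁) ∷ []
  segments v₃ = seg F 0 (spare v₃) ∷ seg Z 0 (overflow v₃) ∷ []
  segments v₅ = seg F 0 (spare v₅) ∷ seg X 0 (overflow v₅) ∷ []
  segments v₂ = seg Y (overflow v₁) (a y) ∷ seg Z (overflow v₃) (a z) ∷ seg F (spare v₁ ⊔ spare v₃) f ∷ []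
  segments v₄ = seg Z (overflow v₃) (a z) ∷ seg X (overflow v₅) (a x) ∷ seg F (spare v₃ ⊔ spare v₅) f ∷ []
  segments v₆ = seg X (overflow v₅) (a x) ∷ seg Y (overflow v₁) (a y) ∷ seg F (spare v₅ ⊔ spare v₁) f ∷ []

  valid : ∀ t → All Valid (segments t)
  valid x  = ≤-refl ∷ []
  valid y  = ≤-refl ∷ []
  valid z  = ≤-refl ∷ []
  valid v₁ = m⊓n≤m f (a v₁) ∷ Sx.overflow-a ∷ []
  valid v₃ = m⊓n≤m f (a v₃) ∷ Sx.overflow-c ∷ []
  valid v₅ = m⊓n≤m f (a v₅) ∷ Sy.overflow-c ∷ []
  valid v₂ = ≤-refl ∷ ≤-refl ∷ ≤-refl ∷ []
  valid v₄ = ≤-refl ∷ ≤-refl ∷ ≤-refl ∷ []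
  valid v₆ = ≤-refl ∷ ≤-refl ∷ ≤-refl ∷ []

  internal : ∀ t → AllPairs Apart (segments t)
  internal x  = [] ∷ []
  internal y  = [] ∷ []
  internal z  = [] ∷ []
  internal v₁ = ((λ ()) ∷ []) ∷ [] ∷ []
  internal v₃ = ((λ ()) ∷ []) ∷ [] ∷ []
  internal v₅ = ((λ ()) ∷ []) ∷ [] ∷ []
  internal v₂ = ((λ ()) ∷ (λ ()) ∷ []) ∷ ((λ ()) ∷ []) ∷ [] ∷ []
  internal v₄ = ((λ ()) ∷ (λ ()) ∷ []) ∷ ((λ ()) ∷ []) ∷ [] ∷ []
  internal v₆ = ((λ ()) ∷ (λ ()) ∷ []) ∷ ((λ ()) ∷ []) ∷ [] ∷ []

  -- Only consecutive cycle vertices share blocks: in the block of a hub the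
  -- odd vertex starts where the overflow of the even one ends, and in F it
  -- starts after the spare colours of both its even neighbours.
  edge-apart : All (λ (s , t) → AllApart (segments s) (segments t)) edges
  edge-apart =
      (((λ ()) ∷ (λ ()) ∷ before (m≤m⊔n _ _) ∷ []) ∷ (before ≤-refl ∷ (λ ()) ∷ (λ ()) ∷ []) ∷ [])
    ∷ (((λ ()) ∷ (λ ()) ∷ []) ∷ ((λ ()) ∷ after ≤-refl ∷ []) ∷ (after (m≤n⊔m _ _) ∷ (λ ()) ∷ []) ∷ [])
    ∷ (((λ ()) ∷ (λ ()) ∷ before (m≤m⊔n _ _) ∷ []) ∷ (before ≤-refl ∷ (λ ()) ∷ (λ ()) ∷ []) ∷ [])
    ∷ (((λ ()) ∷ (λ ()) ∷ []) ∷ ((λ ()) ∷ after ≤-refl ∷ []) ∷ (after (m≤n⊔m _ _) ∷ (λ ()) ∷ []) ∷ [])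
    ∷ (((λ ()) ∷ (λ ()) ∷ before (m≤m⊔n _ _) ∷ []) ∷ (before ≤-refl ∷ (λ ()) ∷ (λ ()) ∷ []) ∷ [])
    ∷ (((λ ()) ∷ (λ ()) ∷ []) ∷ ((λ ()) ∷ after ≤-refl ∷ []) ∷ (after (m≤n⊔m _ _) ∷ (λ ()) ∷ []) ∷ [])
    ∷ (((λ ()) ∷ []) ∷ [])
    ∷ (((λ ()) ∷ []) ∷ [])
    ∷ (((λ ()) ∷ []) ∷ [])
    ∷ (((λ ()) ∷ (λ ()) ∷ []) ∷ [])
    ∷ (((λ ()) ∷ (λ ()) ∷ (λ ()) ∷ []) ∷ [])
    ∷ (((λ ()) ∷ (λ ()) ∷ []) ∷ [])
    ∷ (((λ ()) ∷ (λ ()) ∷ []) ∷ [])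
    ∷ (((λ ()) ∷ (λ ()) ∷ (λ ()) ∷ []) ∷ [])
    ∷ (((λ ()) ∷ (λ ()) ∷ []) ∷ [])
    ∷ (((λ ()) ∷ (λ ()) ∷ []) ∷ [])
    ∷ (((λ ()) ∷ (λ ()) ∷ (λ ()) ∷ []) ∷ [])
    ∷ (((λ ()) ∷ (λ ()) ∷ []) ∷ [])
    ∷ []

  edge-separated : ∀ {s t} → (s , t) ∈ edges → AllApart (segments s) (segments t)
  edge-separated = All.lookup edge-apart

  separated : ∀ {s t} → F3Adj s t → AllApart (segments s) (segments t)
  separated {s} {t} st =
    [ edge-separated , AllApart-sym ∘ edge-separated ]′ (adjacent⇒edge s t st)

  even-wide : ∀ e → a e ≤ spare e + (overflow e + 0)
  even-wide e = ≤-reflexive (sym (trans (cong (spare e +_) (+-identityʳ _)) (m⊓n+n∸m≡n f (a e))))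

  wide : ∀ t → a t ≤ sum (map width (segments t))
  wide x  = m≤m+n (a x) 0
  wide y  = m≤m+n (a y) 0
  wide z  = m≤m+n (a z) 0
  wide v₁ = even-wide v₁
  wide v₃ = even-wide v₃
  wide v₅ = even-wide v₅
  wide v₂ = Sx.capacity
  wide v₄ = Sy.capacity
  wide v₆ = Sz.capacity

  layout : Layout F3Adj a
  layout = record
    { segments = segments ; valid = valid ; internal = internal
    ; separated = separated ; wide = wide }

  colouring : WeightedColouring F3Adj a k
  colouring = subst (WeightedColouring F3Adj a) total≡k (layout-colouring layout)

F3-weighted-colouring : ∀ (a : Fin 9 → ℕ) w →
  (∀ s t r → F3Adj s t → F3Adj s r → F3Adj t r → a s + a t + a r ≤ w) →
  WeightedColouring F3Adj a (ceil5/4 w)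
F3-weighted-colouring = F3Layout.colouring

theorem5p7 : ∀ (n : ℕ) (G : Graph n) (w : ℕ) →
    IsBlowupOfF3 G → IsCliqueNumber G w → Colourable G (ceil5/4 w)
theorem5p7 n G w (p , blowup) (_ , maximal) =
  colour-blowup (F3-weighted-colouring size w (triangle-bound maximal))
  where open Blowup G F3Adj (λ {t} → F3-irreflexive t) p blowup
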